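{- For any connected finite simple graph $G$ of order $n \ge 2$ and any integer $p$ with $1 \le p < n$, $$\gamma(M(G+\overline{K_p})) = p + \min\{\gamma(M(G[A])) : A\subseteq V(G),\ |A| = n-p\}.$$
   Context: $G[A]$ denotes the subgraph of $G$ induced on $A$. $\overline{K_p}$ denotes the edgeless graph on $p$ vertices. The join $G+H$ of graphs with disjoint vertex sets has vertex set $V(G)\cup V(H)$ and edge set $E(G)\cup E(H)\cup\{vw : v\in V(G), w\in V(H)\}$. For a finite simple graph $H$, the middle graph $M(H)$ is the graph with vertex set $V(H)\cup E(H)$ in which two elements $x,y$ are adjacent if and only if either (1) $x,y\in E(H)$ and the edges $x,y$ share a common endpoint in $H$, or (2) $x\in V(H)$, $y\in E(H)$ and $x$ is an endpoint of $y$ (or vice versa). A dominating set of a graph $H$ is a set $S\subseteq V(H)$ such that every vertex of $H$ is in $S$ or adjacent to a vertex of $S$; the domination number $\gamma(H)$ is the minimum cardinality of a dominating set of $H$. -}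

module Defs where

open import Data.Bool using (Bool; true; false)
open import Data.Nat using (ℕ; zero; suc; _+_; _<_; _≤_)
open import Data.Nat.Properties using (<-irrefl; ≤-trans; m≤m+n; +-cancelˡ-≡; ≤-irrelevant)
open import Data.Fin using (Fin; toℕ)
open import Data.Fin.Properties using (toℕ-injective; toℕ<n)
open import Data.Fin.Subset using (Subset) renaming (_∈_ to _∈ˢ_)
open import Data.Vec.Properties.WithK using ([]=-irrelevant)
open import Data.List using (List; length)
open import Data.List.Membership.Propositional using (_∈_)
open import Data.Product using (Σ; _×_; _,_; proj₁; proj₂)
open import Data.Sum using (_⊎_; inj₁; inj₂)
open import Data.Empty using (⊥)
open import Relation.Nullary using (¬_)
open import Relation.Binary.PropositionalEquality
  using (_≡_; _≢_; refl; sym; trans; cong; subst)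
open import Axiom.UniquenessOfIdentityProofs using (module Decidable⇒UIP)
import Data.Bool.Properties as BoolP

record SimpleGraph (n : ℕ) : Set where
  field
    adj       : Fin n → Fin n → Bool
    adj-sym   : ∀ u v → adj u v ≡ adj v u
    adj-irref : ∀ v → adj v v ≡ false
open SimpleGraph public

data Reach {n : ℕ} (G : SimpleGraph n) : Fin n → Fin n → Set where
  here : ∀ {v} → Reach G v v
  step : ∀ {u v w} → adj G u v ≡ true → Reach G v w → Reach G u w

Connected : ∀ {n} → SimpleGraph n → Set
Connected G = ∀ u v → Reach G u v

edgeless : (p : ℕ) → SimpleGraph p
edgeless p = record { adj = λ _ _ → false ; adj-sym = λ _ _ → refl ; adj-irref = λ _ → refl }

-- The labelling is only used to give each
-- (unordered) edge {u,v} a unique representative (rank u < rank v) when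
-- forming the middle graph.

record LGraph : Set₁ where
  field
    V         : Set
    ladj      : V → V → Bool
    ladj-sym  : ∀ u v → ladj u v ≡ ladj v u
    ladj-irref : ∀ v → ladj v v ≡ false
    rank      : V → ℕ
    rank-inj  : ∀ u v → rank u ≡ rank v → u ≡ v
open LGraph public

toL : ∀ {n} → SimpleGraph n → LGraph
toL {n} G = record
  { V = Fin n ; ladj = adj G ; ladj-sym = adj-sym G ; ladj-irref = adj-irref G
  ; rank = toℕ ; rank-inj = λ u v → toℕ-injective }

joinAdj : ∀ {n p} → SimpleGraph n → SimpleGraph p →
          Fin n ⊎ Fin p → Fin n ⊎ Fin p → Bool
joinAdj G H (inj₁ u) (inj₁ v) = adj G u v
joinAdj G H (inj₁ u) (inj₂ v) = true
joinAdj G H (inj₂ u) (inj₁ v) = true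
joinAdj G H (inj₂ u) (inj₂ v) = adj H u v

joinAdj-sym : ∀ {n p} (G : SimpleGraph n) (H : SimpleGraph p) u v →
              joinAdj G H u v ≡ joinAdj G H v u
joinAdj-sym G H (inj₁ u) (inj₁ v) = adj-sym G u v
joinAdj-sym G H (inj₁ u) (inj₂ v) = refl
joinAdj-sym G H (inj₂ u) (inj₁ v) = refl
joinAdj-sym G H (inj₂ u) (inj₂ v) = adj-sym H u v

joinAdj-irref : ∀ {n p} (G : SimpleGraph n) (H : SimpleGraph p) v →
                joinAdj G H v v ≡ false
joinAdj-irref G H (inj₁ v) = adj-irref G v
joinAdj-irref G H (inj₂ v) = adj-irref H v

joinRank : ∀ {n p} → Fin n ⊎ Fin p → ℕ
joinRank     (inj₁ u) = toℕ u
joinRank {n} (inj₂ v) = n + toℕ v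

joinRank-inj : ∀ {n p} (u v : Fin n ⊎ Fin p) → joinRank u ≡ joinRank v → u ≡ v
joinRank-inj (inj₁ u) (inj₁ v) e = cong inj₁ (toℕ-injective e)
joinRank-inj {n} (inj₁ u) (inj₂ v) e with () ← <-irrefl e (≤-trans (toℕ<n u) (m≤m+n n (toℕ v)))
joinRank-inj {n} (inj₂ u) (inj₁ v) e with () ← <-irrefl (sym e) (≤-trans (toℕ<n v) (m≤m+n n (toℕ u)))
joinRank-inj {n} (inj₂ u) (inj₂ v) e = cong inj₂ (toℕ-injective (+-cancelˡ-≡ n _ _ e))

_⊕_ : ∀ {n p} → SimpleGraph n → SimpleGraph p → LGraph
_⊕_ {n} {p} G H = record
  { V = Fin n ⊎ Fin p ; ladj = joinAdj G H ; ladj-sym = joinAdj-sym G H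
  ; ladj-irref = joinAdj-irref G H ; rank = joinRank ; rank-inj = joinRank-inj }

induced : ∀ {n} → SimpleGraph n → Subset n → LGraph
induced {n} G A = record
  { V = Σ (Fin n) (λ v → v ∈ˢ A)
  ; ladj = λ u v → adj G (proj₁ u) (proj₁ v)
  ; ladj-sym = λ u v → adj-sym G (proj₁ u) (proj₁ v)
  ; ladj-irref = λ v → adj-irref G (proj₁ v)
  ; rank = λ v → toℕ (proj₁ v)
  ; rank-inj = inj }
  where
  inj : (u v : Σ (Fin n) (λ v → v ∈ˢ A)) → toℕ (proj₁ u) ≡ toℕ (proj₁ v) → u ≡ v
  inj (u , p) (v , q) e with toℕ-injective e
  ... | refl = cong (u ,_) ([]=-irrelevant p q)

record Graph : Set₁ where
  field
    Vx       : Set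
    Adj      : Vx → Vx → Set
    Adj-sym  : ∀ {u v} → Adj u v → Adj v u
    Adj-irref : ∀ {v} → ¬ Adj v v
open Graph public

-- Edges of a labelled graph: unordered pairs {u,v} represented uniquely
-- by the ordered pair with rank u < rank v.
record Edge (H : LGraph) : Set where
  constructor edge
  field
    src   : V H
    tgt   : V H
    ord   : rank H src < rank H tgt
    isAdj : ladj H src tgt ≡ true
open Edge public

Incident : (H : LGraph) → V H → Edge H → Set
Incident H x e = x ≡ src e ⊎ x ≡ tgt e

MAdj : (H : LGraph) → V H ⊎ Edge H → V H ⊎ Edge H → Set
MAdj H (inj₁ x) (inj₁ y) = ⊥
MAdj H (inj₁ x) (inj₂ e) = Incident H x e
MAdj H (inj₂ e) (inj₁ x) = Incident H x e
MAdj H (inj₂ e) (inj₂ f) = e ≢ f × Σ (V H) (λ x → Incident H x e × Incident H x f)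

MAdj-sym : (H : LGraph) → ∀ {a b} → MAdj H a b → MAdj H b a
MAdj-sym H {inj₁ x} {inj₂ e} i = i
MAdj-sym H {inj₂ e} {inj₁ x} i = i
MAdj-sym H {inj₂ e} {inj₂ f} (ne , x , i , j) = (λ eq → ne (sym eq)) , x , j , i

MAdj-irref : (H : LGraph) → ∀ {a} → ¬ MAdj H a a
MAdj-irref H {inj₁ x} ()
MAdj-irref H {inj₂ e} (ne , _) = ne refl

Middle : LGraph → Graph
Middle H = record
  { Vx = V H ⊎ Edge H ; Adj = MAdj H ; Adj-sym = MAdj-sym H ; Adj-irref = MAdj-irref H }

-- A dominating set is given as a list of vertices; its
-- cardinality is the length.  (Lists with repetitions are never shorter
-- than the underlying set, so the minimum over lists is the minimum over
-- sets.)

Dominating : (H : Graph) → List (Vx H) → Set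
Dominating H S = ∀ v → v ∈ S ⊎ Σ (Vx H) (λ u → u ∈ S × Adj H u v)

IsDomNum : Graph → ℕ → Set
IsDomNum H k =
  Σ (List (Vx H)) (λ S → Dominating H S × length S ≡ k) ×
  (∀ S → Dominating H S → k ≤ length S)

IsMinimum : (ℕ → Set) → ℕ → Set
IsMinimum P b = P b × (∀ c → P c → b ≤ c)

module Submission where

-- Write J = G + K̄ₚ with independent vertices wⱼ = inj₂ j.
-- Upper bound: if ∣ A ∣ = n ∸ p, index the p vertices outside A by Fin p
-- and join the i-th of them to wᵢ; these p "spokes" together with a
-- dominating set of M(G[A]) dominate M(J).
-- Lower bound: in a dominating set S of M(J) every wⱼ has a guard in S,
-- namely wⱼ itself or a spoke u wⱼ with hub u.  Choose A of size n ∸ p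
-- avoiding the (at most p) hubs.  Restricting elements of M(J) to A is a
-- partial retraction onto M(G[A]) that preserves domination and drops the
-- p distinct guards.

open import Defs
open import Data.Nat as ℕ using (ℕ; zero; suc; _+_; _∸_; _≤_; _<_; z≤n; s≤s; _<?_)
open import Data.Nat.Properties
  using (≮⇒≥; ≤-refl; ≤-reflexive; ≤-trans; ≤-antisym; ≤-irrelevant; m<1+n⇒m<n∨m≡n; +-suc; +-monoʳ-≤; <-asym; m≤m+n; ∸-monoʳ-≤; m∸[m∸n]≡n; +-comm; <⇒≤; module ≤-Reasoning)
open import Data.Bool using (true) renaming (_≟_ to _≟ᵇ_)
open import Axiom.UniquenessOfIdentityProofs using (module Decidable⇒UIP)
open import Data.Empty using (⊥-elim) renaming (⊥ to Empty)
open import Data.List using (List; []; _∷_; length; map; _++_; concatMap; mapMaybe; allFin; foldr; lookup; filter)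
open import Data.List.Properties using (length-map; length-++; length-tabulate; length-mapMaybe)
open import Data.List.Membership.Propositional using (_∈_; find; lose)
open import Data.List.Membership.Propositional.Properties using (∈-map⁺; ∈-++⁺ˡ; ∈-++⁺ʳ; ∈-concatMap⁺; ∈-allFin; ∈-filter⁺)
open import Data.List.Relation.Unary.Any as Any using (any?; here; there; index)
open import Data.List.Relation.Unary.Any.Properties using (lookup-index)
open import Data.Maybe as Maybe using (Maybe; just; nothing)
open import Data.Fin as Fin using (Fin; zero; suc; toℕ)
open import Data.Fin.Properties using (injective⇒≤; toℕ<n)
open import Data.Fin.Subset using (Subset; _∉_; _⊆_; ∣_∣; _∪_; ⁅_⁆; ⊥; ∁; inside; outside) renaming (_∈_ to _∈ˢ_)
open import Data.Fin.Subset.Properties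
  using (_∈?_; anySubset?; s⊆s; ⊥⊆; ∣⊥∣≡0; x∈⁅x⁆; ∣⁅x⁆∣≡1; ∣p∣≤∣x∷p∣; ∣∁p∣≡n∸∣p∣; x∈p⇒x∉∁p; x∉p⇒x∈∁p; x∈p∪q⁺)
open import Data.Vec using ([]; _∷_; here; there)
open import Data.Vec.Properties.WithK using ([]=-irrelevant)
open import Data.List.Relation.Unary.All as All using (all?)
open import Data.Product using (Σ; _×_; _,_; proj₁; proj₂)
open import Data.Sum as Sum using (_⊎_; inj₁; inj₂; [_,_]′)
open import Data.Sum.Properties using (≡-dec; inj₁-injective)
open import Relation.Nullary using (¬_; Dec; yes; no; contradiction)
open import Relation.Nullary.Decidable using (_⊎-dec_; _×-dec_; ¬?; map′)
open import Relation.Unary using (Decidable)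
open import Function using (_∘_)
open import Relation.Binary using (DecidableEquality)
open import Relation.Binary.PropositionalEquality using (_≡_; refl; sym; trans; cong; cong₂; subst; module ≡-Reasoning)

record Finite (X : Set) : Set where
  field
    elements : List X
    complete : ∀ x → x ∈ elements
    _≟_      : DecidableEquality X
open Finite

⊎-finite : {X Y : Set} → Finite X → Finite Y → Finite (X ⊎ Y)
⊎-finite fX fY = record
  { elements = map inj₁ (elements fX) ++ map inj₂ (elements fY)
  ; complete = λ where
      (inj₁ x) → ∈-++⁺ˡ (∈-map⁺ inj₁ (complete fX x))
      (inj₂ y) → ∈-++⁺ʳ (map inj₁ (elements fX)) (∈-map⁺ inj₂ (complete fY y))
  ; _≟_ = ≡-dec (_≟_ fX) (_≟_ fY) }

module _ {X : Set} (fX : Finite X) {P : X → Set} (P? : Decidable P) where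

  exists? : Dec (Σ X P)
  exists? with any? P? (elements fX)
  ... | yes found = yes (proj₁ (find found) , proj₂ (proj₂ (find found)))
  ... | no none   = no λ (x , px) → none (lose (complete fX x) px)

  forall? : Dec (∀ x → P x)
  forall? with all? P? (elements fX)
  ... | yes every = yes λ x → All.lookup every (complete fX x)
  ... | no ¬every = no λ f → ¬every (All.tabulate λ {x} _ → f x)

lists? : {X : Set} → Finite X → {Q : List X → Set} → Decidable Q →
         ∀ k → Dec (Σ (List X) (λ xs → Q xs × length xs ≡ k))
lists? fX Q? zero with Q? []
... | yes q = yes ([] , q , refl)
... | no ¬q = no λ where ([] , q , _) → ¬q q
lists? fX {Q} Q? (suc k) with exists? fX (λ x → lists? fX (λ xs → Q? (x ∷ xs)) k)
... | yes (x , xs , q , refl) = yes (x ∷ xs , q , refl)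
... | no none = no λ where (x ∷ xs , q , refl) → none (x , xs , q , refl)

module _ {Q : ℕ → Set} (Q? : Decidable Q) where

  private
    search : ∀ m → (∀ c → c < m → ¬ Q c) ⊎ Σ ℕ (IsMinimum Q)
    search zero = inj₁ λ _ ()
    search (suc m) with search m
    ... | inj₂ min = inj₂ min
    ... | inj₁ below with Q? m
    ...   | yes qm = inj₂ (m , qm , λ c qc → ≮⇒≥ λ c<m → below c c<m qc)
    ...   | no ¬qm = inj₁ λ c c≤m → [ below c , (λ { refl → ¬qm }) ]′ (m<1+n⇒m<n∨m≡n c≤m)

  minimum : ∀ {m} → Q m → Σ ℕ (IsMinimum Q)
  minimum {m} qm with search (suc m)
  ... | inj₂ min   = min
  ... | inj₁ below = ⊥-elim (below m ≤-refl qm)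

Dominates : (H : Graph) → List (Vx H) → Vx H → Set
Dominates H S v = v ∈ S ⊎ Σ (Vx H) (λ u → u ∈ S × Adj H u v)

-- A finite graph with decidable adjacency has a domination number: the
-- least length of a dominating list (the enumeration itself dominates).
module _ (H : Graph) (fH : Finite (Vx H)) (adj? : ∀ u v → Dec (Adj H u v)) where

  dominating? : ∀ S → Dec (Dominating H S)
  dominating? S = forall? fH λ v → (v ∈ˡ? S) ⊎-dec adjacent? v
    where
    open import Data.List.Membership.DecPropositional (_≟_ fH) using () renaming (_∈?_ to _∈ˡ?_)
    adjacent? : ∀ v → Dec (Σ (Vx H) (λ u → u ∈ S × Adj H u v))
    adjacent? v = map′ (λ a → proj₁ (find a) , proj₂ (find a)) (λ (u , m , a) → lose m a)
                       (any? (λ u → adj? u v) S)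

  domination-number : Σ ℕ (IsDomNum H)
  domination-number with minimum (lists? fH dominating?) (elements fH , (λ v → inj₁ (complete fH v)) , refl)
  ... | k , witness , least = k , witness , λ S d → least (length S) (S , d , refl)

domination-number-unique : ∀ H {k l} → IsDomNum H k → IsDomNum H l → k ≡ l
domination-number-unique H ((S , dS , refl) , leastS) ((T , dT , refl) , leastT) =
  ≤-antisym (leastS T dT) (leastT S dS)

-- An edge is determined by its endpoints: the order and adjacency proofs
-- are propositions.
edge-ext : (H : LGraph) {e f : Edge H} → src e ≡ src f → tgt e ≡ tgt f → e ≡ f
edge-ext H {edge s t o a} {edge .s .t o′ a′} refl refl
  rewrite ≤-irrelevant o o′ | Decidable⇒UIP.≡-irrelevant _≟ᵇ_ a a′ = refl

module _ (H : LGraph) (fV : Finite (V H)) where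

  edges-between : V H → V H → List (Edge H)
  edges-between u v with rank H u <? rank H v | ladj H u v Data.Bool.≟ true
  ... | yes o | yes a = edge u v o a ∷ []
  ... | _     | _     = []

  edges-between-complete : ∀ e → e ∈ edges-between (src e) (tgt e)
  edges-between-complete (edge u v o a) with rank H u <? rank H v | ladj H u v Data.Bool.≟ true
  ... | yes _ | yes _ = here (edge-ext H refl refl)
  ... | yes _ | no ¬a = contradiction a ¬a
  ... | no ¬o | _     = contradiction o ¬o

  edge-finite : Finite (Edge H)
  edge-finite = record
    { elements = concatMap (λ u → concatMap (edges-between u) (elements fV)) (elements fV)
    ; complete = λ e → ∈-concatMap⁺ _ (Any.map (λ { refl →
                         ∈-concatMap⁺ _ (Any.map (λ { refl → edges-between-complete e })
                                                 (complete fV (tgt e))) })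
                                      (complete fV (src e)))
    ; _≟_ = λ e f → map′ (λ (s , t) → edge-ext H s t) (λ { refl → refl , refl })
                         (_≟_ fV (src e) (src f) ×-dec _≟_ fV (tgt e) (tgt f)) }

  middle-finite : Finite (Vx (Middle H))
  middle-finite = ⊎-finite fV edge-finite

  incident? : ∀ x e → Dec (Incident H x e)
  incident? x e = _≟_ fV x (src e) ⊎-dec _≟_ fV x (tgt e)

  middle-adj? : ∀ a b → Dec (MAdj H a b)
  middle-adj? (inj₁ x) (inj₁ y) = no λ ()
  middle-adj? (inj₁ x) (inj₂ e) = incident? x e
  middle-adj? (inj₂ e) (inj₁ x) = incident? x e
  middle-adj? (inj₂ e) (inj₂ f) =
    ¬? (_≟_ edge-finite e f) ×-dec exists? fV (λ x → incident? x e ×-dec incident? x f)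

  middle-domination-number : Σ ℕ (IsDomNum (Middle H))
  middle-domination-number = domination-number (Middle H) middle-finite middle-adj?

Member : ∀ {n} → Subset n → Set
Member {n} A = Σ (Fin n) (_∈ˢ A)

-- Membership proofs are unique, so members are determined by their vertex.
member-ext : ∀ {n} {A : Subset n} {v w : Fin n} {a : v ∈ˢ A} {b : w ∈ˢ A} →
             v ≡ w → _≡_ {A = Member A} (v , a) (w , b)
member-ext {a = a} {b} refl = cong (_ ,_) ([]=-irrelevant a b)

asMember : ∀ {n} (A : Subset n) → Fin n → Maybe (Member A)
asMember A v with v ∈? A
... | yes a = just (v , a)
... | no _  = nothing

asMember-∈ : ∀ {n} {A : Subset n} {v} (a : v ∈ˢ A) → asMember A v ≡ just (v , a)
asMember-∈ {A = A} {v} a with v ∈? A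
... | yes a′ = cong just (member-ext {A = A} refl)
... | no ¬a  = contradiction a ¬a

asMember-∉ : ∀ {n} {A : Subset n} {v} → v ∉ A → asMember A v ≡ nothing
asMember-∉ {A = A} {v} ¬a with v ∈? A
... | yes a = contradiction a ¬a
... | no _  = refl

∈-mapMaybe⁺ : {X Y : Set} (f : X → Maybe Y) {xs : List X} {x : X} {y : Y} →
              x ∈ xs → f x ≡ just y → y ∈ mapMaybe f xs
∈-mapMaybe⁺ f {x ∷ xs} (here refl) fx rewrite fx = here refl
∈-mapMaybe⁺ f {x ∷ xs} (there m) fx with f x
... | just _  = there (∈-mapMaybe⁺ f m fx)
... | nothing = ∈-mapMaybe⁺ f m fx

member-finite : ∀ {n} (A : Subset n) → Finite (Member A)
member-finite {n} A = record
  { elements = mapMaybe (asMember A) (allFin n)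
  ; complete = λ (v , a) → ∈-mapMaybe⁺ (asMember A) (∈-allFin v) (asMember-∈ a)
  ; _≟_ = λ (v , _) (w , _) → map′ member-ext (cong proj₁) (v Fin.≟ w) }

∣p∪q∣≤∣p∣+∣q∣ : ∀ {n} (p q : Subset n) → ∣ p ∪ q ∣ ≤ ∣ p ∣ + ∣ q ∣
∣p∪q∣≤∣p∣+∣q∣ []            []            = z≤n
∣p∪q∣≤∣p∣+∣q∣ (inside  ∷ p) (s ∷ q)       = s≤s (≤-trans (∣p∪q∣≤∣p∣+∣q∣ p q) (+-monoʳ-≤ ∣ p ∣ (∣p∣≤∣x∷p∣ s q)))
∣p∪q∣≤∣p∣+∣q∣ (outside ∷ p) (inside  ∷ q) = ≤-trans (s≤s (∣p∪q∣≤∣p∣+∣q∣ p q)) (≤-reflexive (sym (+-suc ∣ p ∣ ∣ q ∣)))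
∣p∪q∣≤∣p∣+∣q∣ (outside ∷ p) (outside ∷ q) = ∣p∪q∣≤∣p∣+∣q∣ p q

fromList : ∀ {n} → List (Fin n) → Subset n
fromList = foldr (λ u B → ⁅ u ⁆ ∪ B) ⊥

∣fromList∣≤length : ∀ {n} (us : List (Fin n)) → ∣ fromList us ∣ ≤ length us
∣fromList∣≤length {n} [] = ≤-reflexive (∣⊥∣≡0 n)
∣fromList∣≤length (u ∷ us) = ≤-trans (∣p∪q∣≤∣p∣+∣q∣ ⁅ u ⁆ (fromList us))
  (≤-trans (≤-reflexive (cong (_+ ∣ fromList us ∣) (∣⁅x⁆∣≡1 u))) (s≤s (∣fromList∣≤length us)))

∈-fromList : ∀ {n} {us : List (Fin n)} {u} → u ∈ us → u ∈ˢ fromList us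
∈-fromList (here refl) = x∈p∪q⁺ (inj₁ (x∈⁅x⁆ _))
∈-fromList (there m)   = x∈p∪q⁺ (inj₂ (∈-fromList m))

shrink : ∀ {n k} (C : Subset n) → k ≤ ∣ C ∣ → Σ (Subset n) (λ A → A ⊆ C × ∣ A ∣ ≡ k)
shrink {n} {zero} C _ = ⊥ , ⊥⊆ , ∣⊥∣≡0 n
shrink {k = suc k} (inside ∷ C) (s≤s k≤∣C∣) with shrink C k≤∣C∣
... | A , A⊆C , ∣A∣ = inside ∷ A , s⊆s A⊆C , cong suc ∣A∣
shrink {k = suc k} (outside ∷ C) k≤∣C∣ with shrink C k≤∣C∣
... | A , A⊆C , ∣A∣ = outside ∷ A , s⊆s A⊆C , ∣A∣

avoiding-subset : ∀ {n p} (us : List (Fin n)) → length us ≤ p →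
                  Σ (Subset n) (λ A → ∣ A ∣ ≡ n ∸ p × (∀ {u} → u ∈ us → u ∉ A))
avoiding-subset {n} {p} us ∣us∣≤p with shrink (∁ (fromList us)) n∸p≤∣C∣
  where
  n∸p≤∣C∣ : n ∸ p ≤ ∣ ∁ (fromList us) ∣
  n∸p≤∣C∣ = ≤-trans (∸-monoʳ-≤ n (≤-trans (∣fromList∣≤length us) ∣us∣≤p))
                    (≤-reflexive (sym (∣∁p∣≡n∸∣p∣ (fromList us))))
... | A , A⊆C , ∣A∣ = A , ∣A∣ , λ u∈us u∈A → x∈p⇒x∉∁p (∈-fromList u∈us) (A⊆C u∈A)

members : ∀ {n} → Subset n → List (Fin n)
members []            = []
members (inside  ∷ B) = zero ∷ map suc (members B)
members (outside ∷ B) = map suc (members B)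

members-length : ∀ {n} (B : Subset n) → length (members B) ≡ ∣ B ∣
members-length []            = refl
members-length (inside  ∷ B) = cong suc (trans (length-map suc (members B)) (members-length B))
members-length (outside ∷ B) = trans (length-map suc (members B)) (members-length B)

members-complete : ∀ {n} {B : Subset n} {v} → v ∈ˢ B → v ∈ members B
members-complete {B = inside  ∷ B} here      = here refl
members-complete {B = inside  ∷ B} (there m) = there (∈-map⁺ suc (members-complete m))
members-complete {B = outside ∷ B} (there m) = ∈-map⁺ suc (members-complete m)

indexing : {X : Set} {p : ℕ} (xs : List X) → length xs ≡ p →
           Σ (Fin p → X) (λ m → ∀ {x} → x ∈ xs → Σ (Fin p) (λ i → m i ≡ x))
indexing xs refl = lookup xs , λ x∈xs → index x∈xs , sym (lookup-index x∈xs)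

outside-indexing : ∀ {n p} (A : Subset n) → ∣ A ∣ ≡ n ∸ p → p ≤ n →
                   Σ (Fin p → Fin n) (λ m → ∀ v → v ∉ A → Σ (Fin p) (λ i → m i ≡ v))
outside-indexing {n} {p} A ∣A∣ p≤n with indexing (members (∁ A)) length≡p
  where
  open ≡-Reasoning
  length≡p : length (members (∁ A)) ≡ p
  length≡p = begin
    length (members (∁ A)) ≡⟨ members-length (∁ A) ⟩
    ∣ ∁ A ∣                ≡⟨ ∣∁p∣≡n∸∣p∣ A ⟩
    n ∸ ∣ A ∣              ≡⟨ cong (n ∸_) ∣A∣ ⟩
    n ∸ (n ∸ p)            ≡⟨ m∸[m∸n]≡n p≤n ⟩
    p                      ∎
... | m , covers = m , λ v v∉A → covers (members-complete (x∉p⇒x∈∁p v∉A))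

dominates-mono : ∀ H {S T : List (Vx H)} → (∀ {x} → x ∈ S → x ∈ T) → ∀ {v} → Dominates H S v → Dominates H T v
dominates-mono H S⊆T (inj₁ v∈S)         = inj₁ (S⊆T v∈S)
dominates-mono H S⊆T (inj₂ (u , u∈S , a)) = inj₂ (u , S⊆T u∈S , a)

dominating-extension : (H K : Graph) (emb : Vx K → Vx H) →
  (∀ {a b} → Adj K a b → Adj H (emb a) (emb b)) →
  (D : List (Vx K)) (M : List (Vx H)) → Dominating K D →
  (∀ v → Σ (Vx K) (λ y → emb y ≡ v) ⊎ Dominates H M v) →
  Dominating H (map emb D ++ M)
dominating-extension H K emb hom D M dom covered v with covered v
... | inj₂ byM = dominates-mono H (∈-++⁺ʳ (map emb D)) byM
... | inj₁ (y , refl) with dom y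
...   | inj₁ y∈D             = inj₁ (∈-++⁺ˡ (∈-map⁺ emb y∈D))
...   | inj₂ (u , u∈D , a)   = inj₂ (emb u , ∈-++⁺ˡ (∈-map⁺ emb u∈D) , hom a)

dominating-restriction : (H K : Graph) (emb : Vx K → Vx H) (ρ : Vx H → Maybe (Vx K)) →
  (∀ x → ρ (emb x) ≡ just x) →
  (∀ x s → Adj H s (emb x) → Σ (Vx K) (λ y → ρ s ≡ just y × (y ≡ x ⊎ Adj K y x))) →
  ∀ S → Dominating H S → Dominating K (mapMaybe ρ S)
dominating-restriction H K emb ρ retract near S dom x with dom (emb x)
... | inj₁ x∈S = inj₁ (∈-mapMaybe⁺ ρ x∈S (retract x))
... | inj₂ (s , s∈S , a) with near x s a
...   | y , ρs , inj₁ refl = inj₁ (∈-mapMaybe⁺ ρ s∈S ρs)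
...   | y , ρs , inj₂ a′   = inj₂ (y , ∈-mapMaybe⁺ ρ s∈S ρs , a′)

Dropped : {X Y : Set} → (X → Maybe Y) → X → Set
Dropped f x = f x ≡ nothing

dropped? : {X Y : Set} (f : X → Maybe Y) → Decidable (Dropped f)
dropped? f x with f x
... | just _  = no λ ()
... | nothing = yes refl

length-mapMaybe-filter : {X Y : Set} (f : X → Maybe Y) (xs : List X) →
  length (mapMaybe f xs) + length (filter (dropped? f) xs) ≡ length xs
length-mapMaybe-filter f [] = refl
length-mapMaybe-filter f (x ∷ xs) with f x
... | just _  = cong suc (length-mapMaybe-filter f xs)
... | nothing = trans (+-suc _ _) (cong suc (length-mapMaybe-filter f xs))

injection-length : {X : Set} {p : ℕ} (g : Fin p → X) → (∀ {i j} → g i ≡ g j → i ≡ j) →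
                   (xs : List X) → (∀ i → g i ∈ xs) → p ≤ length xs
injection-length g g-inj xs g∈xs = injective⇒≤ {f = λ i → index (g∈xs i)} index-inj
  where
  index-inj : ∀ {i j} → index (g∈xs i) ≡ index (g∈xs j) → i ≡ j
  index-inj {i} {j} eq = g-inj (trans (lookup-index (g∈xs i))
                                      (trans (cong (lookup xs) eq) (sym (lookup-index (g∈xs j)))))

mapMaybe-drops : {X Y : Set} {p : ℕ} (f : X → Maybe Y) (g : Fin p → X) →
  (∀ {i j} → g i ≡ g j → i ≡ j) → (xs : List X) → (∀ i → g i ∈ xs × Dropped f (g i)) →
  length (mapMaybe f xs) + p ≤ length xs
mapMaybe-drops {p = p} f g g-inj xs dropped = begin
  length (mapMaybe f xs) + p                               ≤⟨ +-monoʳ-≤ _ p≤filter ⟩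
  length (mapMaybe f xs) + length (filter (dropped? f) xs) ≡⟨ length-mapMaybe-filter f xs ⟩
  length xs                                                ∎
  where
  open ≤-Reasoning
  p≤filter : p ≤ length (filter (dropped? f) xs)
  p≤filter = injection-length g g-inj (filter (dropped? f) xs)
               (λ i → ∈-filter⁺ (dropped? f) (proj₁ (dropped i)) (proj₂ (dropped i)))

module Join {n : ℕ} (G : SimpleGraph n) (p : ℕ) where

  J : LGraph
  J = G ⊕ edgeless p

  MJ : Graph
  MJ = Middle J

  -- Every edge of J starts in G: its other endpoint has the larger label
  -- and two independent vertices are never adjacent.
  starts-in-G : ∀ (x : Fin p) t → joinRank {n} {p} (inj₂ x) < joinRank t →
                joinAdj G (edgeless p) (inj₂ x) t ≡ true → Empty
  starts-in-G x (inj₁ v) o _ = <-asym (≤-trans (toℕ<n v) (m≤m+n n (toℕ x))) o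
  starts-in-G x (inj₂ y) _ ()

  data Guard (j : Fin p) : Vx MJ → Set where
    itself : Guard j (inj₁ (inj₂ j))
    spoke  : ∀ u o a → Guard j (inj₂ (edge (inj₁ u) (inj₂ j) o a))

  hub : ∀ {j s} → Guard j s → Maybe (Fin n)
  hub itself         = nothing
  hub (spoke u _ _)  = just u

  guard-unique : ∀ {j k s} → Guard j s → Guard k s → j ≡ k
  guard-unique itself        itself        = refl
  guard-unique (spoke _ _ _) (spoke _ _ _) = refl

  guard : ∀ {S} → Dominating MJ S → (j : Fin p) → Σ (Vx MJ) (λ s → s ∈ S × Guard j s)
  guard dom j with dom (inj₁ (inj₂ j))
  ... | inj₁ wⱼ∈S = _ , wⱼ∈S , itself
  ... | inj₂ (inj₂ (edge (inj₁ u) (inj₂ _) o a) , s∈S , inj₂ refl) = _ , s∈S , spoke u o a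
  ... | inj₂ (inj₂ (edge (inj₁ u) (inj₁ _) _ _) , _ , inj₂ ())
  ... | inj₂ (inj₂ (edge (inj₁ u) _ _ _) , _ , inj₁ ())
  ... | inj₂ (inj₂ (edge (inj₂ x) t o a) , _) = ⊥-elim (starts-in-G x t o a)

  guards : ∀ S → Dominating MJ S →
           Σ (Fin p → Vx MJ) (λ g → (∀ j → g j ∈ S) × (∀ j → Guard j (g j)))
  guards S dom = (λ j → proj₁ (guard dom j)) , (λ j → proj₁ (proj₂ (guard dom j))) , (λ j → proj₂ (proj₂ (guard dom j)))

  hubs : {g : Fin p → Vx MJ} → (∀ j → Guard j (g j)) → List (Fin n)
  hubs guarded = mapMaybe (λ j → hub (guarded j)) (allFin p)

  hubs-length : {g : Fin p → Vx MJ} (guarded : ∀ j → Guard j (g j)) → length (hubs guarded) ≤ p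
  hubs-length guarded = ≤-trans (length-mapMaybe _ (allFin p)) (≤-reflexive (length-tabulate (λ i → i)))

  hubs-complete : {g : Fin p → Vx MJ} (guarded : ∀ j → Guard j (g j)) →
                  ∀ j {u} → hub (guarded j) ≡ just u → u ∈ hubs guarded
  hubs-complete guarded j = ∈-mapMaybe⁺ _ (∈-allFin j)

  module OnSubset (A : Subset n) where

    GA : LGraph
    GA = induced G A

    MGA : Graph
    MGA = Middle GA

    embV : V GA → V J
    embV (v , _) = inj₁ v

    embE : Edge GA → Edge J
    embE (edge s t o a) = edge (embV s) (embV t) o a

    emb : Vx MGA → Vx MJ
    emb (inj₁ x) = inj₁ (embV x)
    emb (inj₂ e) = inj₂ (embE e)

    embV-injective : ∀ {x y} → embV x ≡ embV y → x ≡ y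
    embV-injective refl = member-ext {A = A} refl

    embE-injective : ∀ {e f} → embE e ≡ embE f → e ≡ f
    embE-injective eq = edge-ext GA (embV-injective (cong src eq)) (embV-injective (cong tgt eq))

    incident-emb : ∀ x e → Incident GA x e → Incident J (embV x) (embE e)
    incident-emb x e = Sum.map (cong embV) (cong embV)

    incident-reflect : ∀ x e → Incident J (embV x) (embE e) → Incident GA x e
    incident-reflect x e = Sum.map embV-injective embV-injective

    incident-emb⁻¹ : ∀ {w} e → Incident J w (embE e) → Σ (V GA) (λ x → w ≡ embV x × Incident GA x e)
    incident-emb⁻¹ e (inj₁ refl) = src e , refl , inj₁ refl
    incident-emb⁻¹ e (inj₂ refl) = tgt e , refl , inj₂ refl

    emb-hom : ∀ {a b} → MAdj GA a b → MAdj J (emb a) (emb b)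
    emb-hom {inj₁ x} {inj₂ e} i = incident-emb x e i
    emb-hom {inj₂ e} {inj₁ x} i = incident-emb x e i
    emb-hom {inj₂ e} {inj₂ f} (e≢f , x , i , j) =
      (λ eq → e≢f (embE-injective eq)) , embV x , incident-emb x e i , incident-emb x f j

    restrict-edge : ∀ u v (o : toℕ u < toℕ v) (a : adj G u v ≡ true) →
                    Dec (u ∈ˢ A) → Dec (v ∈ˢ A) → Maybe (Vx MGA)
    restrict-edge u v o a (yes au) (yes av) = just (inj₂ (edge (u , au) (v , av) o a))
    restrict-edge u v o a (yes au) (no _)   = just (inj₁ (u , au))
    restrict-edge u v o a (no _)   (yes av) = just (inj₁ (v , av))
    restrict-edge u v o a (no _)   (no _)   = nothing

    ρ : Vx MJ → Maybe (Vx MGA)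
    ρ (inj₁ (inj₁ v))                       = Maybe.map inj₁ (asMember A v)
    ρ (inj₁ (inj₂ _))                       = nothing
    ρ (inj₂ (edge (inj₁ u) (inj₁ v) o a))   = restrict-edge u v o a (u ∈? A) (v ∈? A)
    ρ (inj₂ (edge (inj₁ u) (inj₂ _) _ _))   = Maybe.map inj₁ (asMember A u)
    ρ (inj₂ (edge (inj₂ _) _ _ _))          = nothing

    retract : ∀ x → ρ (emb x) ≡ just x
    retract (inj₁ (v , a)) = cong (Maybe.map inj₁) (asMember-∈ a)
    retract (inj₂ (edge (u , au) (v , av) o a)) with u ∈? A | v ∈? A
    ... | yes _ | yes _  = cong (just ∘ inj₂) (edge-ext GA (member-ext {A = A} refl) (member-ext {A = A} refl))
    ... | no ¬u | _      = contradiction au ¬u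
    ... | yes _ | no ¬v  = contradiction av ¬v

    restrict-at : ∀ {z} (za : z ∈ˢ A) f → Incident J (inj₁ z) f →
                  ρ (inj₂ f) ≡ just (inj₁ (z , za)) ⊎
                  Σ (Edge GA) (λ f′ → ρ (inj₂ f) ≡ just (inj₂ f′) × embE f′ ≡ f)
    restrict-at za (edge (inj₁ u) (inj₁ v) o a) _ with u ∈? A | v ∈? A
    ... | yes au | yes av = inj₂ (edge (u , au) (v , av) o a , refl , refl)
    restrict-at za (edge (inj₁ u) (inj₁ v) o a) (inj₁ refl) | yes _ | no _ = inj₁ (cong (just ∘ inj₁) (member-ext {A = A} refl))
    restrict-at za (edge (inj₁ u) (inj₁ v) o a) (inj₁ refl) | no ¬u | _    = contradiction za ¬u
    restrict-at za (edge (inj₁ u) (inj₁ v) o a) (inj₂ refl) | _ | no ¬v    = contradiction za ¬v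
    restrict-at za (edge (inj₁ u) (inj₁ v) o a) (inj₂ refl) | no _ | yes _ = inj₁ (cong (just ∘ inj₁) (member-ext {A = A} refl))
    restrict-at za (edge (inj₁ u) (inj₂ _) o a) (inj₁ refl) = inj₁ (cong (Maybe.map inj₁) (asMember-∈ za))
    restrict-at za (edge (inj₂ x) t o a) _ = ⊥-elim (starts-in-G x t o a)

    restrict-near : ∀ x s → MAdj J s (emb x) → Σ (Vx MGA) (λ y → ρ s ≡ just y × (y ≡ x ⊎ MAdj GA y x))
    restrict-near (inj₁ (z , za)) (inj₂ f) inc with restrict-at za f inc
    ... | inj₁ ρf = _ , ρf , inj₁ refl
    ... | inj₂ (f′ , ρf , refl) = _ , ρf , inj₂ (incident-reflect (z , za) f′ inc)
    restrict-near (inj₂ e) (inj₁ w) inc with incident-emb⁻¹ e inc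
    ... | y , refl , i = _ , retract (inj₁ y) , inj₂ i
    restrict-near (inj₂ e) (inj₂ f) (f≢e , w , i-f , i-e) with incident-emb⁻¹ e i-e
    ... | (z , za) , refl , i with restrict-at za f i-f
    ...   | inj₁ ρf = _ , ρf , inj₂ i
    ...   | inj₂ (f′ , ρf , refl) =
            _ , ρf , inj₂ ((λ eq → f≢e (cong embE eq)) , (z , za) , incident-reflect (z , za) f′ i-f , i)

    guard-dropped : ∀ {j s} (g : Guard j s) → (∀ {u} → hub g ≡ just u → u ∉ A) → ρ s ≡ nothing
    guard-dropped itself        _     = refl
    guard-dropped (spoke u _ _) avoid = cong (Maybe.map inj₁) (asMember-∉ (avoid refl))

    restriction-bound : ∀ S → (guardian : Fin p → Vx MJ) (guarded : ∀ j → Guard j (guardian j)) →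
      (∀ j → guardian j ∈ S) → (∀ j {u} → hub (guarded j) ≡ just u → u ∉ A) →
      length (mapMaybe ρ S) + p ≤ length S
    restriction-bound S guardian guarded in-S avoid = mapMaybe-drops ρ guardian injective S dropped
      where
      injective : ∀ {i j} → guardian i ≡ guardian j → i ≡ j
      injective {i} {j} eq = guard-unique (guarded i) (subst (Guard j) (sym eq) (guarded j))
      dropped : ∀ j → guardian j ∈ S × Dropped ρ (guardian j)
      dropped j = in-S j , guard-dropped (guarded j) (avoid j)

    module Matching (m : Fin p → Fin n) (covers : ∀ v → v ∉ A → Σ (Fin p) (λ i → m i ≡ v)) where

      spoke-edge : Fin p → Edge J
      spoke-edge i = edge (inj₁ (m i)) (inj₂ i) (≤-trans (toℕ<n (m i)) (m≤m+n n (toℕ i))) refl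

      spokes : List (Vx MJ)
      spokes = map (inj₂ ∘ spoke-edge) (allFin p)

      spoke-∈ : ∀ i → inj₂ (spoke-edge i) ∈ spokes
      spoke-∈ i = ∈-map⁺ (inj₂ ∘ spoke-edge) (∈-allFin i)

      via-spoke : ∀ i {x} → MAdj J (inj₂ (spoke-edge i)) x → Dominates MJ spokes x
      via-spoke i a = inj₂ (_ , spoke-∈ i , a)

      covered : ∀ x → Σ (Vx MGA) (λ y → emb y ≡ x) ⊎ Dominates MJ spokes x
      covered (inj₁ (inj₁ v)) with v ∈? A
      ... | yes a = inj₁ (inj₁ (v , a) , refl)
      ... | no ¬a with covers v ¬a
      ...   | i , refl = inj₂ (via-spoke i (inj₁ refl))
      covered (inj₁ (inj₂ j)) = inj₂ (via-spoke j (inj₂ refl))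
      covered (inj₂ (edge (inj₁ u) (inj₁ v) o a)) with u ∈? A | v ∈? A
      ... | yes au | yes av = inj₁ (inj₂ (edge (u , au) (v , av) o a) , refl)
      ... | no ¬u  | _ with covers u ¬u
      ...   | i , refl = inj₂ (via-spoke i ((λ ()) , inj₁ (m i) , inj₁ refl , inj₁ refl))
      covered (inj₂ (edge (inj₁ u) (inj₁ v) o a)) | yes _ | no ¬v with covers v ¬v
      ...   | i , refl = inj₂ (via-spoke i ((λ ()) , inj₁ (m i) , inj₁ refl , inj₂ refl))
      covered (inj₂ (edge (inj₁ u) (inj₂ j) o a)) with m j Fin.≟ u
      ... | yes refl = inj₂ (inj₁ (subst (_∈ spokes) (cong inj₂ (edge-ext J refl refl)) (spoke-∈ j)))
      ... | no mj≢u = inj₂ (via-spoke j ((λ eq → mj≢u (inj₁-injective (cong src eq))) , inj₂ j , inj₂ refl , inj₂ refl))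
      covered (inj₂ (edge (inj₂ x) t o a)) = ⊥-elim (starts-in-G x t o a)

      upper-bound : ∀ D → Dominating MGA D → Σ (List (Vx MJ)) (λ S → Dominating MJ S × length S ≡ length D + p)
      upper-bound D dom = map emb D ++ spokes
                        , dominating-extension MJ MGA emb emb-hom D spokes dom covered
                        , size
        where
        open ≡-Reasoning
        size : length (map emb D ++ spokes) ≡ length D + p
        size = begin
          length (map emb D ++ spokes)          ≡⟨ length-++ (map emb D) ⟩
          length (map emb D) + length spokes    ≡⟨ cong₂ _+_ (length-map emb D) (length-map _ (allFin p)) ⟩
          length D + length (allFin p)          ≡⟨ cong (length D +_) (length-tabulate (λ i → i)) ⟩
          length D + p                          ∎

  lower-bound : ∀ S → Dominating MJ S →
    Σ (Subset n) (λ A → ∣ A ∣ ≡ n ∸ p ×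
      Σ (List (Vx (Middle (induced G A)))) (λ D → Dominating (Middle (induced G A)) D × length D + p ≤ length S))
  lower-bound S dom with guards S dom
  ... | guardian , in-S , guarded with avoiding-subset (hubs guarded) (hubs-length guarded)
  ... | A , ∣A∣ , avoids = A , ∣A∣ , mapMaybe ρ S
                         , dominating-restriction MJ MGA emb ρ retract restrict-near S dom
                         , restriction-bound S guardian guarded in-S (λ j h → avoids (hubs-complete guarded j h))
    where open OnSubset A

Candidate : ∀ {n} → SimpleGraph n → ℕ → ℕ → Set
Candidate {n} G p c = Σ (Subset n) (λ A → ∣ A ∣ ≡ n ∸ p × IsDomNum (Middle (induced G A)) c)

induced-domination-number : ∀ {n} (G : SimpleGraph n) (A : Subset n) → Σ ℕ (IsDomNum (Middle (induced G A)))
induced-domination-number G A = middle-domination-number (induced G A) (member-finite A)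

least-candidate : ∀ {n} (G : SimpleGraph n) p → Σ ℕ (IsMinimum (Candidate G p))
least-candidate {n} G p with avoiding-subset {p = p} [] z≤n
... | A , ∣A∣ , _ = minimum candidate? (A , ∣A∣ , proj₂ (induced-domination-number G A))
  where
  is-domination-number? : ∀ A c → Dec (IsDomNum (Middle (induced G A)) c)
  is-domination-number? A c with induced-domination-number G A
  ... | k , γk with c ℕ.≟ k
  ...   | yes refl = yes γk
  ...   | no c≢k   = no λ γc → c≢k (domination-number-unique (Middle (induced G A)) γc γk)

  candidate? : Decidable (Candidate G p)
  candidate? c = anySubset? λ A → (∣ A ∣ ℕ.≟ n ∸ p) ×-dec is-domination-number? A c

join-domination-number : ∀ {n} (G : SimpleGraph n) {p b} → p ≤ n → IsMinimum (Candidate G p) b →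
                         IsDomNum (Middle (G ⊕ edgeless p)) (p + b)
join-domination-number {n} G {p} p≤n ((A , ∣A∣ , (D , dom , refl) , _) , least)
  with outside-indexing A ∣A∣ p≤n
... | m , covers with Matching.upper-bound m covers D dom
  where open Join G p; open OnSubset A
... | S , domS , ∣S∣ = (S , domS , trans ∣S∣ (+-comm (length D) p)) , lower
  where
  lower : ∀ T → Dominating (Middle (G ⊕ edgeless p)) T → p + length D ≤ length T
  lower T domT with Join.lower-bound G p T domT
  ... | A′ , ∣A′∣ , D′ , domD′ , bound with induced-domination-number G A′
  ... | k , γk = begin
    p + length D   ≤⟨ +-monoʳ-≤ p (least k (A′ , ∣A′∣ , γk)) ⟩
    p + k          ≤⟨ +-monoʳ-≤ p (proj₂ γk D′ domD′) ⟩
    p + length D′  ≡⟨ +-comm p (length D′) ⟩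
    length D′ + p  ≤⟨ bound ⟩
    length T       ∎
    where open ≤-Reasoning

theorem2p18 : (n : ℕ) (G : SimpleGraph n) → 2 ≤ n → Connected G →
    (p : ℕ) → 1 ≤ p → p < n →
    Σ ℕ (λ b →
    IsMinimum (λ c → Σ (Subset n) (λ A → ∣ A ∣ ≡ n ∸ p × IsDomNum (Middle (induced G A)) c)) b
    × IsDomNum (Middle (G ⊕ edgeless p)) (p + b))
theorem2p18 n G _ _ p _ p<n with least-candidate G p
... | b , minimal = b , minimal , join-domination-number G (<⇒≤ p<n) minimal
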